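{- Let $G$ be any graph on $n$ vertices. Then for any positive number $t$, $$Smon_t(G)=P\beta_{nt/2}(G).$$
   Context: Graphs are finite, simple and undirected. A threshold assignment for $G$ is a map $\tau:V(G)\to\mathbb{N}\cup\{0\}$ with $0\le\tau(v)\le d_G(v)$ for every $v$; its average is $\bar\tau=\sum_{v}\tau(v)/|V(G)|$. A $\tau$-monopoly is a set $M\subseteq V(G)$ such that every $v\in V(G)\setminus M$ has at least $\tau(v)$ neighbors in $M$; $mon_\tau(G)$ is the minimum size of a $\tau$-monopoly. For $t>0$, $Smon_t(G)=\min\{mon_\tau(G): \tau \text{ a threshold assignment with } \bar\tau\ge t\}$. For a real number $s$, $P\beta_s(G)$ is the minimum size of a set $S\subseteq V(G)$ such that at least $s$ edges of $G$ have an endpoint in $S$.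
   Formalization: The parameter t ranges over the positive rationals. -}

module Defs where

open import Data.Nat as ℕ using (ℕ; _≤_; NonZero)
open import Data.Bool using (Bool; true; false; _∧_; _∨_; if_then_else_)
open import Data.Fin using (Fin; toℕ)
open import Data.Fin.Subset using (Subset; _∈_; _∉_; _∩_; ∣_∣)
open import Data.List using (map; allFin)
open import Data.Nat.ListAction using (sum)
open import Data.Vec using (tabulate; lookup)
open import Data.Integer using (+_)
open import Data.Rational as ℚ using (ℚ; _/_; ½)
open import Data.Product using (Σ; _×_; ∃)
open import Relation.Binary.PropositionalEquality using (_≡_)

record Graph (n : ℕ) : Set where
  field
    adj     : Fin n → Fin n → Bool
    adj-sym : ∀ u v → adj u v ≡ adj v u
    irrefl  : ∀ v → adj v v ≡ false
open Graph public

module _ {n : ℕ} (G : Graph n) where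

  N : Fin n → Subset n
  N v = tabulate (adj G v)

  deg : Fin n → ℕ
  deg v = ∣ N v ∣

  IsThreshold : (Fin n → ℕ) → Set
  IsThreshold τ = ∀ v → τ v ≤ deg v

  IsMonopoly : (Fin n → ℕ) → Subset n → Set
  IsMonopoly τ M = ∀ v → v ∉ M → τ v ≤ ∣ N v ∩ M ∣

  IsMon : (Fin n → ℕ) → ℕ → Set
  IsMon τ k = (Σ (Subset n) λ M → IsMonopoly τ M × ∣ M ∣ ≡ k)
            × (∀ M → IsMonopoly τ M → k ≤ ∣ M ∣)

  coveredEdges : Subset n → ℕ
  coveredEdges S = sum (map (λ i → sum (map (λ j →
      if (toℕ i ℕ.<ᵇ toℕ j) ∧ adj G i j ∧ (lookup S i ∨ lookup S j) then 1 else 0)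
      (allFin n))) (allFin n))

  IsPβ : ℚ → ℕ → Set
  IsPβ s k = (Σ (Subset n) λ S → s ℚ.≤ (+ coveredEdges S / 1) × ∣ S ∣ ≡ k)
           × (∀ S → s ℚ.≤ (+ coveredEdges S / 1) → k ≤ ∣ S ∣)

  avg : .{{_ : NonZero n}} → (Fin n → ℕ) → ℚ
  avg τ = + sum (map τ (allFin n)) / n

  IsSmon : .{{_ : NonZero n}} → ℚ → ℕ → Set
  IsSmon t k = (Σ (Fin n → ℕ) λ τ → IsThreshold τ × t ℚ.≤ avg τ × IsMon τ k)
             × (∀ τ → IsThreshold τ → t ℚ.≤ avg τ → ∀ m → IsMon τ m → k ≤ m)

-- For S ⊆ V let τ_S(v) be the number of edges at v with an endpoint in S, that is d(v) for
-- v ∈ S and |N(v) ∩ S| otherwise. It is a threshold assignment for which S is a monopoly,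
-- its values sum to twice the number e(S) of edges covered by S, and it dominates pointwise
-- every threshold assignment τ for which S is a τ-monopoly. Hence a τ-monopoly M with
-- τ̄ ≥ t covers at least (Σ τ)/2 ≥ nt/2 edges, while a set S covering at least nt/2 edges
-- is a τ_S-monopoly with τ̄_S = 2e(S)/n ≥ t; so the two minima coincide.

module Submission where

open import Defs
open import Data.Nat as ℕ using (ℕ; zero; suc; _+_; _≤_; _<_; _<ᵇ_; _≤?_; _<?_; NonZero)
import Data.Nat.Properties as ℕP
open import Data.Integer as ℤ using (+_)
import Data.Integer.Properties as ℤP
open import Data.Rational as ℚ using (ℚ; Positive; _/_; _*_; ½; toℚᵘ)
import Data.Rational.Properties as ℚP
import Data.Rational.Unnormalised as ℚᵘ
import Data.Rational.Unnormalised.Properties as ℚᵘP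
open import Data.Bool using (Bool; true; false; _∧_; _∨_; if_then_else_)
import Data.Bool.Properties as BoolP
open import Data.Fin using (Fin; toℕ) renaming (zero to fzero; suc to fsuc)
import Data.Fin.Properties as FinP
open import Data.Fin.Subset using (Subset; _∩_; ∣_∣; inside; outside)
import Data.Fin.Subset.Properties as SubsetP
open import Data.List as List using (map; allFin)
import Data.List.Properties as ListP
open import Data.Nat.ListAction using (sum)
open import Data.Vec using ([]; _∷_; lookup)
import Data.Vec.Properties as VecP
open import Data.Product using (Σ-syntax; ∃; _×_; _,_)
open import Data.Empty using (⊥-elim)
open import Function using (id; _∘_; _⇔_; mk⇔; Equivalence)
import Function.Properties.Equivalence as ⇔
open import Relation.Binary using (tri<; tri≈; tri>)
open import Relation.Binary.PropositionalEquality
open import Relation.Nullary using (¬_; contradiction; Dec; yes; no; ¬?; _×-dec_; _→-dec_)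
open import Relation.Unary using (Pred; Decidable)
open import Algebra.Properties.CommutativeMonoid.Sum ℕP.+-0-commutativeMonoid
  using (∑-distrib-+; ∑-comm; sum-cong-≗) renaming (sum to ∑)
open import Algebra.Properties.Monoid.Sum ℕP.+-0-monoid using (sum-syntax)

-- `+ x / suc m` unfolds to `fromℚᵘ (mkℚᵘ (+ x) m)`.
toℚᵘ-/suc : ∀ x m → toℚᵘ (+ x / suc m) ℚᵘ.≃ ℚᵘ.mkℚᵘ (+ x) m
toℚᵘ-/suc x m = ℚP.toℚᵘ-fromℚᵘ (ℚᵘ.mkℚᵘ (+ x) m)

/-monoˡ-≤ : ∀ m {x y} → x ≤ y → + x / suc m ℚ.≤ + y / suc m
/-monoˡ-≤ m {x} {y} x≤y = ℚP.toℚᵘ-cancel-≤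
  (ℚᵘP.≤-respˡ-≃ (ℚᵘP.≃-sym (toℚᵘ-/suc x m)) (ℚᵘP.≤-respʳ-≃ (ℚᵘP.≃-sym (toℚᵘ-/suc y m))
    (ℚᵘ.*≤* (ℤP.*-monoʳ-≤-nonNeg (+ suc m) (ℤ.+≤+ x≤y)))))

n*[x/n]≡x : ∀ m x → (+ suc m / 1) * (+ x / suc m) ≡ + x / 1
n*[x/n]≡x m x = ℚP.toℚᵘ-injective (let open ℚᵘP.≃-Reasoning in begin
  toℚᵘ ((+ suc m / 1) * (+ x / suc m))
    ≈⟨ ℚP.toℚᵘ-homo-* (+ suc m / 1) (+ x / suc m) ⟩
  toℚᵘ (+ suc m / 1) ℚᵘ.* toℚᵘ (+ x / suc m)
    ≈⟨ ℚᵘP.*-cong (toℚᵘ-/suc (suc m) 0) (toℚᵘ-/suc x m) ⟩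
  ℚᵘ.mkℚᵘ (+ suc m) 0 ℚᵘ.* ℚᵘ.mkℚᵘ (+ x) m
    ≈⟨ ℚᵘ.*≡* cross-multiplied ⟩
  ℚᵘ.mkℚᵘ (+ x) 0
    ≈⟨ ℚᵘP.≃-sym (toℚᵘ-/suc x 0) ⟩
  toℚᵘ (+ x / 1) ∎)
  where
  cross-multiplied : + suc m ℤ.* + x ℤ.* + 1 ≡ + x ℤ.* + suc (m + 0)
  cross-multiplied = begin
    + suc m ℤ.* + x ℤ.* + 1  ≡⟨ ℤP.*-identityʳ _ ⟩
    + suc m ℤ.* + x          ≡⟨ ℤP.*-comm (+ suc m) (+ x) ⟩
    + x ℤ.* + suc m          ≡⟨ cong (λ k → + x ℤ.* + suc k) (sym (ℕP.+-identityʳ m)) ⟩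
    + x ℤ.* + suc (m + 0)    ∎
    where open ≡-Reasoning

[2*c]*½≡c : ∀ c → (+ (2 ℕ.* c) / 1) * ½ ≡ + c / 1
[2*c]*½≡c c = ℚP.toℚᵘ-injective (let open ℚᵘP.≃-Reasoning in begin
  toℚᵘ ((+ (2 ℕ.* c) / 1) * ½)
    ≈⟨ ℚP.toℚᵘ-homo-* (+ (2 ℕ.* c) / 1) ½ ⟩
  toℚᵘ (+ (2 ℕ.* c) / 1) ℚᵘ.* toℚᵘ ½
    ≈⟨ ℚᵘP.*-cong (toℚᵘ-/suc (2 ℕ.* c) 0) (toℚᵘ-/suc 1 1) ⟩
  ℚᵘ.mkℚᵘ (+ (2 ℕ.* c)) 0 ℚᵘ.* ℚᵘ.mkℚᵘ (+ 1) 1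
    ≈⟨ ℚᵘ.*≡* cross-multiplied ⟩
  ℚᵘ.mkℚᵘ (+ c) 0
    ≈⟨ ℚᵘP.≃-sym (toℚᵘ-/suc c 0) ⟩
  toℚᵘ (+ c / 1) ∎)
  where
  cross-multiplied : + (2 ℕ.* c) ℤ.* + 1 ℤ.* + 1 ≡ + c ℤ.* + 2
  cross-multiplied = begin
    + (2 ℕ.* c) ℤ.* + 1 ℤ.* + 1  ≡⟨ ℤP.*-identityʳ _ ⟩
    + (2 ℕ.* c) ℤ.* + 1          ≡⟨ ℤP.*-identityʳ _ ⟩
    + (2 ℕ.* c)                  ≡⟨ cong +_ (ℕP.*-comm 2 c) ⟩
    + (c ℕ.* 2)                  ≡⟨ ℤP.pos-* c 2 ⟩
    + c ℤ.* + 2                  ∎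
    where open ≡-Reasoning

≤/suc⇔suc*≤ : ∀ m t x → t ℚ.≤ + x / suc m ⇔ (+ suc m / 1) * t ℚ.≤ + x / 1
≤/suc⇔suc*≤ m t x = mk⇔
  (λ t≤x/n → subst (_ ℚ.≤_) (n*[x/n]≡x m x) (ℚP.*-monoˡ-≤-nonNeg n t≤x/n))
  (λ nt≤x → ℚP.*-cancelˡ-≤-pos n (subst (_ ℚ.≤_) (sym (n*[x/n]≡x m x)) nt≤x))
  where
  n : ℚ
  n = + suc m / 1
  instance
    n-pos : Positive n
    n-pos = ℚP.normalize-pos (suc m) 1
    n-nonNeg : ℚ.NonNegative n
    n-nonNeg = ℚP.pos⇒nonNeg n

*½≤⇔≤2* : ∀ q c → q * ½ ℚ.≤ + c / 1 ⇔ q ℚ.≤ + (2 ℕ.* c) / 1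
*½≤⇔≤2* q c = mk⇔
  (λ q½≤c → ℚP.*-cancelʳ-≤-pos ½ (subst (_ ℚ.≤_) (sym ([2*c]*½≡c c)) q½≤c))
  (λ q≤2c → subst (_ ℚ.≤_) ([2*c]*½≡c c) (ℚP.*-monoʳ-≤-nonNeg ½ q≤2c))

≤[2*c]/suc⇔suc*t*½≤c : ∀ m t c → t ℚ.≤ + (2 ℕ.* c) / suc m ⇔ (+ suc m / 1) * t * ½ ℚ.≤ + c / 1
≤[2*c]/suc⇔suc*t*½≤c m t c = ⇔.trans (≤/suc⇔suc*≤ m t (2 ℕ.* c)) (⇔.sym (*½≤⇔≤2* ((+ suc m / 1) * t) c))

indicator : Bool → ℕ
indicator b = if b then 1 else 0

sum-allFin≡∑ : ∀ {n} (f : Fin n → ℕ) → sum (map f (allFin n)) ≡ ∑[ i < n ] f i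
sum-allFin≡∑ {n} f = trans (cong sum (ListP.map-tabulate id f)) (sum-tabulate f)
  where
  sum-tabulate : ∀ {n} (g : Fin n → ℕ) → sum (List.tabulate g) ≡ ∑[ i < n ] g i
  sum-tabulate {zero} g = refl
  sum-tabulate {suc n} g = cong (_+_ (g fzero)) (sum-tabulate (g ∘ fsuc))

∑-mono-≤ : ∀ {n} {f g : Fin n → ℕ} → (∀ i → f i ≤ g i) → ∑[ i < n ] f i ≤ ∑[ i < n ] g i
∑-mono-≤ {zero} f≤g = ℕ.z≤n
∑-mono-≤ {suc n} f≤g = ℕP.+-mono-≤ (f≤g fzero) (∑-mono-≤ (f≤g ∘ fsuc))

∣p∣≡∑ : ∀ {n} (p : Subset n) → ∣ p ∣ ≡ ∑[ i < n ] indicator (lookup p i)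
∣p∣≡∑ [] = refl
∣p∣≡∑ (inside ∷ p) = cong suc (∣p∣≡∑ p)
∣p∣≡∑ (outside ∷ p) = ∣p∣≡∑ p

<ᵇ≡true : ∀ {m n} → m < n → (m <ᵇ n) ≡ true
<ᵇ≡true m<n = Equivalence.to BoolP.T-≡ (ℕP.<⇒<ᵇ m<n)

<ᵇ≡false : ∀ {m n} → ¬ m < n → (m <ᵇ n) ≡ false
<ᵇ≡false {m} {n} m≮n = BoolP.¬-not (m≮n ∘ ℕP.<ᵇ⇒< m n ∘ Equivalence.from BoolP.T-≡)

module _ {n : ℕ} (r : Fin n → Fin n → Bool)
         (r-sym : ∀ i j → r i j ≡ r j i) (r-irrefl : ∀ i → r i i ≡ false) where

  ∑∑-symmetric≡2*∑∑-upper : ∑[ i < n ] ∑[ j < n ] indicator (r i j)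
                          ≡ 2 ℕ.* ∑[ i < n ] ∑[ j < n ] indicator ((toℕ i <ᵇ toℕ j) ∧ r i j)
  ∑∑-symmetric≡2*∑∑-upper = begin
    ∑[ i < n ] ∑[ j < n ] indicator (r i j)
      ≡⟨ sum-cong-≗ (λ i → sum-cong-≗ (indicator-split i)) ⟩
    ∑[ i < n ] ∑[ j < n ] (upper i j + upper j i)
      ≡⟨ sum-cong-≗ (λ i → ∑-distrib-+ (upper i) (λ j → upper j i)) ⟩
    ∑[ i < n ] (∑[ j < n ] upper i j + ∑[ j < n ] upper j i)
      ≡⟨ ∑-distrib-+ (λ i → ∑[ j < n ] upper i j) (λ i → ∑[ j < n ] upper j i) ⟩
    U + ∑[ i < n ] ∑[ j < n ] upper j i
      ≡⟨ cong (_+_ U) (∑-comm (λ i j → upper j i)) ⟩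
    U + U
      ≡⟨ cong (_+_ U) (sym (ℕP.+-identityʳ U)) ⟩
    2 ℕ.* U ∎
    where
    open ≡-Reasoning

    upper : Fin n → Fin n → ℕ
    upper i j = indicator ((toℕ i <ᵇ toℕ j) ∧ r i j)

    U : ℕ
    U = ∑[ i < n ] ∑[ j < n ] upper i j

    indicator-split : ∀ i j → indicator (r i j) ≡ upper i j + upper j i
    indicator-split i j with ℕP.<-cmp (toℕ i) (toℕ j)
    ... | tri< i<j _ j≮i rewrite <ᵇ≡true i<j | <ᵇ≡false j≮i = sym (ℕP.+-identityʳ _)
    ... | tri> i≮j _ j<i rewrite <ᵇ≡false i≮j | <ᵇ≡true j<i = cong indicator (r-sym i j)
    ... | tri≈ _ i≡j _ rewrite FinP.toℕ-injective i≡j | r-irrefl j | BoolP.∧-zeroʳ (toℕ j <ᵇ toℕ j) = refl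

module _ {n ℓ} {P : Pred (Subset n) ℓ} (P? : Decidable P) where

  ∃-minimum : ∀ {S} → P S → Σ[ M ∈ Subset n ] P M × (∀ M′ → P M′ → ∣ M ∣ ≤ ∣ M′ ∣)
  ∃-minimum {S} PS = descend ∣ S ∣ S ℕP.≤-refl PS
    where
    descend : ∀ k S → ∣ S ∣ ≤ k → P S → Σ[ M ∈ Subset n ] P M × (∀ M′ → P M′ → ∣ M ∣ ≤ ∣ M′ ∣)
    descend k S ∣S∣≤k PS with SubsetP.anySubset? (λ M → P? M ×-dec (∣ M ∣ <? ∣ S ∣))
    ... | no ∄smaller = S , PS , λ M PM → ℕP.≮⇒≥ (λ ∣M∣<∣S∣ → ∄smaller (M , PM , ∣M∣<∣S∣))
    descend zero S ∣S∣≤0 PS | yes (_ , _ , ∣M∣<∣S∣) = contradiction (ℕP.<-≤-trans ∣M∣<∣S∣ ∣S∣≤0) ℕP.n≮0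
    descend (suc k) S ∣S∣≤1+k PS | yes (M , PM , ∣M∣<∣S∣) = descend k M (ℕ.s≤s⁻¹ (ℕP.≤-trans ∣M∣<∣S∣ ∣S∣≤1+k)) PM

module _ {n : ℕ} (G : Graph n) where

  covers : Subset n → Fin n → Fin n → Bool
  covers S i j = adj G i j ∧ (lookup S i ∨ lookup S j)

  coveredDegree : Subset n → Fin n → ℕ
  coveredDegree S v = if lookup S v then deg G v else ∣ N G v ∩ S ∣

  coveredDegree≡∑covers : ∀ S v → coveredDegree S v ≡ ∑[ j < n ] indicator (covers S v j)
  coveredDegree≡∑covers S v with lookup S v
  ... | true = trans (∣p∣≡∑ (N G v)) (sum-cong-≗ λ j →
        cong indicator (trans (VecP.lookup∘tabulate (adj G v) j) (sym (BoolP.∧-identityʳ (adj G v j)))))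
  ... | false = trans (∣p∣≡∑ (N G v ∩ S)) (sum-cong-≗ λ j →
        cong indicator (trans (VecP.lookup-zipWith _∧_ j (N G v) S)
                              (cong (_∧ lookup S j) (VecP.lookup∘tabulate (adj G v) j))))

  coveredEdges≡∑∑ : ∀ S → coveredEdges G S ≡ ∑[ i < n ] ∑[ j < n ] indicator ((toℕ i <ᵇ toℕ j) ∧ covers S i j)
  coveredEdges≡∑∑ S = trans (sum-allFin≡∑ {n} _) (sum-cong-≗ {n} λ i → sum-allFin≡∑ {n} _)

  ∑coveredDegree≡2*coveredEdges : ∀ S → ∑[ v < n ] coveredDegree S v ≡ 2 ℕ.* coveredEdges G S
  ∑coveredDegree≡2*coveredEdges S = begin
    ∑[ i < n ] coveredDegree S i
      ≡⟨ sum-cong-≗ (coveredDegree≡∑covers S) ⟩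
    ∑[ i < n ] ∑[ j < n ] indicator (covers S i j)
      ≡⟨ ∑∑-symmetric≡2*∑∑-upper (covers S) covers-sym covers-irrefl ⟩
    2 ℕ.* ∑[ i < n ] ∑[ j < n ] indicator ((toℕ i <ᵇ toℕ j) ∧ covers S i j)
      ≡⟨ cong (2 ℕ.*_) (sym (coveredEdges≡∑∑ S)) ⟩
    2 ℕ.* coveredEdges G S ∎
    where
    open ≡-Reasoning
    covers-sym : ∀ i j → covers S i j ≡ covers S j i
    covers-sym i j = cong₂ _∧_ (adj-sym G i j) (BoolP.∨-comm (lookup S i) (lookup S j))
    covers-irrefl : ∀ i → covers S i i ≡ false
    covers-irrefl i = cong (_∧ _) (irrefl G i)

  coveredDegree-isThreshold : ∀ S → IsThreshold G (coveredDegree S)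
  coveredDegree-isThreshold S v with lookup S v
  ... | true = ℕP.≤-refl
  ... | false = SubsetP.∣p∩q∣≤∣p∣ (N G v) S

  coveredDegree-isMonopoly : ∀ S → IsMonopoly G (coveredDegree S) S
  coveredDegree-isMonopoly S v v∉S with lookup S v in Sv≡true
  ... | true = ⊥-elim (v∉S (VecP.lookup⇒[]= v S Sv≡true))
  ... | false = ℕP.≤-refl

  ≤coveredDegree : ∀ {τ M} → IsThreshold G τ → IsMonopoly G τ M → ∀ v → τ v ≤ coveredDegree M v
  ≤coveredDegree {M = M} τ≤deg M-mono v with lookup M v in Mv≡false
  ... | true = τ≤deg v
  ... | false = M-mono v λ v∈M → contradiction (trans (sym (VecP.[]=⇒lookup v∈M)) Mv≡false) λ ()

  isMonopoly? : ∀ τ M → Dec (IsMonopoly G τ M)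
  isMonopoly? τ M = FinP.all? λ v → ¬? (v SubsetP.∈? M) →-dec (τ v ≤? ∣ N G v ∩ M ∣)

  ∃-IsMon : ∀ {τ M} → IsMonopoly G τ M → ∃ (IsMon G τ)
  ∃-IsMon {τ} M-mono with ∃-minimum (isMonopoly? τ) M-mono
  ... | M₀ , M₀-mono , minimal = ∣ M₀ ∣ , (M₀ , M₀-mono , refl) , minimal

module _ {m : ℕ} (G : Graph (suc m)) (t : ℚ) where

  avg≡∑/ : ∀ τ → avg G τ ≡ + (∑[ v < suc m ] τ v) / suc m
  avg≡∑/ τ = cong (λ s → + s / suc m) (sum-allFin≡∑ τ)

  monopoly⇒nt/2≤coveredEdges : ∀ {τ M} → IsThreshold G τ → t ℚ.≤ avg G τ → IsMonopoly G τ M →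
                               (+ suc m / 1) * t * ½ ℚ.≤ + coveredEdges G M / 1
  monopoly⇒nt/2≤coveredEdges {τ} {M} τ≤deg t≤avg M-mono =
    Equivalence.to (≤[2*c]/suc⇔suc*t*½≤c m t (coveredEdges G M))
      (ℚP.≤-trans (subst (t ℚ.≤_) (avg≡∑/ τ) t≤avg) (/-monoˡ-≤ m ∑τ≤2e))
    where
    ∑τ≤2e : ∑[ v < suc m ] τ v ≤ 2 ℕ.* coveredEdges G M
    ∑τ≤2e = ℕP.≤-trans (∑-mono-≤ (≤coveredDegree G τ≤deg M-mono))
                       (ℕP.≤-reflexive (∑coveredDegree≡2*coveredEdges G M))

  nt/2≤coveredEdges⇒t≤avg : ∀ S → (+ suc m / 1) * t * ½ ℚ.≤ + coveredEdges G S / 1 →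
                            t ℚ.≤ avg G (coveredDegree G S)
  nt/2≤coveredEdges⇒t≤avg S nt/2≤e = subst (t ℚ.≤_) avg≡2e/n
    (Equivalence.from (≤[2*c]/suc⇔suc*t*½≤c m t (coveredEdges G S)) nt/2≤e)
    where
    avg≡2e/n : + (2 ℕ.* coveredEdges G S) / suc m ≡ avg G (coveredDegree G S)
    avg≡2e/n = sym (trans (avg≡∑/ (coveredDegree G S))
                          (cong (λ s → + s / suc m) (∑coveredDegree≡2*coveredEdges G S)))

mainTheorem6 : (n : ℕ) .{{_ : NonZero n}} (G : Graph n) (t : ℚ) → Positive t →
    ∀ k → IsSmon G t k ⇔ IsPβ G ((+ n / 1) * t * ½) k
mainTheorem6 (suc m) G t _ k = mk⇔ Smon⇒Pβ Pβ⇒Smon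
  where
  Smon⇒Pβ : IsSmon G t k → IsPβ G ((+ suc m / 1) * t * ½) k
  Smon⇒Pβ ((τ , τ≤deg , t≤avg , (M , M-mono , ∣M∣≡k) , _) , Smon-min) =
    (M , monopoly⇒nt/2≤coveredEdges G t τ≤deg t≤avg M-mono , ∣M∣≡k) , k≤∣S∣
    where
    k≤∣S∣ : ∀ S → (+ suc m / 1) * t * ½ ℚ.≤ + coveredEdges G S / 1 → k ≤ ∣ S ∣
    k≤∣S∣ S nt/2≤e with ∃-IsMon G (coveredDegree-isMonopoly G S)
    ... | monₛ , isMonₛ@(_ , monₛ-minimal) =
      ℕP.≤-trans (Smon-min (coveredDegree G S) (coveredDegree-isThreshold G S)
                           (nt/2≤coveredEdges⇒t≤avg G t S nt/2≤e) monₛ isMonₛ)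
                 (monₛ-minimal S (coveredDegree-isMonopoly G S))

  Pβ⇒Smon : IsPβ G ((+ suc m / 1) * t * ½) k → IsSmon G t k
  Pβ⇒Smon ((S , nt/2≤e , ∣S∣≡k) , Pβ-min) =
    ( coveredDegree G S , coveredDegree-isThreshold G S , t≤avgₛ
    , (S , coveredDegree-isMonopoly G S , ∣S∣≡k) , k≤∣M∣ (coveredDegree-isThreshold G S) t≤avgₛ)
    , λ τ τ≤deg t≤avg _ ((M , M-mono , ∣M∣≡mon) , _) → subst (k ≤_) ∣M∣≡mon (k≤∣M∣ τ≤deg t≤avg M M-mono)
    where
    t≤avgₛ : t ℚ.≤ avg G (coveredDegree G S)
    t≤avgₛ = nt/2≤coveredEdges⇒t≤avg G t S nt/2≤e

    k≤∣M∣ : ∀ {τ} → IsThreshold G τ → t ℚ.≤ avg G τ → ∀ M → IsMonopoly G τ M → k ≤ ∣ M ∣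
    k≤∣M∣ τ≤deg t≤avg M M-mono = Pβ-min M (monopoly⇒nt/2≤coveredEdges G t τ≤deg t≤avg M-mono)
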